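{- Let $E$ be a set and let $\tau:\mathcal{P}(E)\to\mathcal{P}(E)$ be an antimatroidal quasi-closure operator on $E$. For any $F\subseteq E$ define \[ \operatorname{Shade}F=\{e\in E \mid e\notin\tau(F\setminus\{e\})\}. \] Then $\operatorname{Shade}:\mathcal{P}(E)\to\mathcal{P}(E)$ is an inclusion-reversing shade map.
   Context: $\mathcal{P}(E)$ is the power set of $E$. A quasi-closure operator on $E$ is a map $\tau:\mathcal{P}(E)\to\mathcal{P}(E)$ with (1) $A\subseteq\tau(A)$ for all $A\subseteq E$; (2) $A\subseteq B\subseteq E$ implies $\tau(A)\subseteq\tau(B)$; (3) $\tau(\tau(A))=\tau(A)$ for all $A\subseteq E$. It is antimatroidal if moreover: whenever $X\subseteq E$ and $y,z$ are two distinct elements of $E\setminus\tau(X)$ with $z\in\tau(X\cup\{y\})$, then $y\notin\tau(X\cup\{z\})$. A map $S:\mathcal{P}(E)\to\mathcal{P}(E)$ is inclusion-reversing if $A\subseteq B$ implies $S(B)\subseteq S(A)$. A shade map on $E$ is a map $S:\mathcal{P}(E)\to\mathcal{P}(E)$ such that for every $F\subseteq E$ and every $u\in E\setminus S(F)$ we have $S(F\cup\{u\})=S(F)$ and $S(F\setminus\{u\})=S(F)$. -}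

module Defs where

open import Level using (Level; suc)
open import Data.Product using (_×_)
open import Relation.Nullary using (¬_)
open import Relation.Binary.PropositionalEquality using (_≡_)
open import Relation.Unary using (Pred; _∈_; _∉_; _⊆_; _∪_; _∖_; ｛_｝; _≐_)

-- Subsets of E are predicates E → Set ℓ (E itself lives in Set ℓ so that
-- singletons, unions and differences stay at level ℓ).

module _ {ℓ : Level} {E : Set ℓ} where

  record IsQuasiClosure (τ : Pred E ℓ → Pred E ℓ) : Set (suc ℓ) where
    field
      extensive  : ∀ A → A ⊆ τ A
      monotone   : ∀ {A B} → A ⊆ B → τ A ⊆ τ B
      idempotent : ∀ A → τ (τ A) ≐ τ A

  IsAntimatroidal : (Pred E ℓ → Pred E ℓ) → Set (suc ℓ)
  IsAntimatroidal τ =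
    ∀ (X : Pred E ℓ) (y z : E) → ¬ (y ≡ z) → y ∉ τ X → z ∉ τ X →
      z ∈ τ (X ∪ ｛ y ｝) → y ∉ τ (X ∪ ｛ z ｝)

  IsAntimatroidalQuasiClosure : (Pred E ℓ → Pred E ℓ) → Set (suc ℓ)
  IsAntimatroidalQuasiClosure τ = IsQuasiClosure τ × IsAntimatroidal τ

  InclusionReversing : (Pred E ℓ → Pred E ℓ) → Set (suc ℓ)
  InclusionReversing S = ∀ {A B : Pred E ℓ} → A ⊆ B → S B ⊆ S A

  IsShadeMap : (Pred E ℓ → Pred E ℓ) → Set (suc ℓ)
  IsShadeMap S = ∀ (F : Pred E ℓ) (u : E) → u ∉ S F →
    (S (F ∪ ｛ u ｝) ≐ S F) × (S (F ∖ ｛ u ｝) ≐ S F)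

  Shade : (Pred E ℓ → Pred E ℓ) → Pred E ℓ → Pred E ℓ
  Shade τ F e = e ∉ τ (F ∖ ｛ e ｝)

-- A non-shade point u of F lies in τ (F ∖ {u}), and then u is irrelevant to
-- whether any e ≠ u is a shade point: were e ∈ τ (F ∖ {e}) while
-- e ∉ τ (F ∖ {e, u}), then with X = F ∖ {e, u} both u ∈ τ (X ∪ {e}) and
-- e ∈ τ (X ∪ {u}), contradicting the antimatroid exchange condition.
-- So Shade F depends only on F ∖ {u}, which adding or removing u leaves fixed.
module Submission where

open import Defs
open import Level using (Level)
open import Data.Product using (_×_; _,_; proj₁; proj₂)
open import Data.Empty using (⊥-elim)
open import Data.Sum using (inj₁; inj₂)
open import Relation.Nullary using (¬_; yes; no)
open import Relation.Unary using (Pred; _∈_; _∉_; _⊆_; _∪_; _∖_; ｛_｝; _≐_)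
open import Relation.Binary.PropositionalEquality using (_≡_; refl)
open import Axiom.ExcludedMiddle using (ExcludedMiddle)

module _ {ℓ : Level} {E : Set ℓ} where

  ∪-∖-same : ∀ {B : Pred E ℓ} u → (B ∪ ｛ u ｝) ∖ ｛ u ｝ ≐ B ∖ ｛ u ｝
  ∪-∖-same u = (λ { (inj₁ b , u≢x) → b , u≢x ; (inj₂ u≡x , u≢x) → ⊥-elim (u≢x u≡x) })
             , λ (b , u≢x) → inj₁ b , u≢x

  ∖-∖-same : ∀ {B : Pred E ℓ} u → (B ∖ ｛ u ｝) ∖ ｛ u ｝ ≐ B ∖ ｛ u ｝
  ∖-∖-same u = proj₁ , λ (b , u≢x) → (b , u≢x) , u≢x

  ∖-∪-cover : ExcludedMiddle ℓ → ∀ {B : Pred E ℓ} v → B ⊆ (B ∖ ｛ v ｝) ∪ ｛ v ｝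
  ∖-∪-cover em v {x} b with em {v ≡ x}
  ... | yes v≡x = inj₂ v≡x
  ... | no  v≢x = inj₁ (b , v≢x)

module _ {ℓ : Level} {E : Set ℓ} {τ : Pred E ℓ → Pred E ℓ} where

  Shade-antitone : (∀ {A B} → A ⊆ B → τ A ⊆ τ B) → InclusionReversing (Shade τ)
  Shade-antitone monotone A⊆B e∉τB∖e e∈τA∖e =
    e∉τB∖e (monotone (λ (a , a≢e) → A⊆B a , a≢e) e∈τA∖e)

  τ-absorbs : IsQuasiClosure τ → ∀ {A u} → u ∈ τ A → τ (A ∪ ｛ u ｝) ⊆ τ A
  τ-absorbs qc {A} {u} u∈τA x∈τA∪u = proj₁ (idempotent A) (monotone A∪u⊆τA x∈τA∪u)
    where
    open IsQuasiClosure qc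
    A∪u⊆τA : A ∪ ｛ u ｝ ⊆ τ A
    A∪u⊆τA (inj₁ a)    = extensive A a
    A∪u⊆τA (inj₂ refl) = u∈τA

  module _ (em : ExcludedMiddle ℓ) (hτ : IsAntimatroidalQuasiClosure τ) where
    open IsQuasiClosure (proj₁ hτ)

    Shade-from-∖-nonshade : ∀ {F u e} → u ∉ Shade τ F → ¬ u ≡ e →
                            Shade τ (F ∖ ｛ u ｝) e → Shade τ F e
    Shade-from-∖-nonshade {F} {u} {e} u∉ShadeF u≢e e∉τX e∈τF∖e = u∉ShadeF λ u∈τF∖u →
      proj₂ hτ X u e u≢e u∉τX e∉τX
        (monotone F∖e⊆X∪u e∈τF∖e) (monotone F∖u⊆X∪e u∈τF∖u)
      where
      X : Pred E ℓ
      X = (F ∖ ｛ u ｝) ∖ ｛ e ｝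

      F∖u⊆X∪e : F ∖ ｛ u ｝ ⊆ X ∪ ｛ e ｝
      F∖u⊆X∪e = ∖-∪-cover em {F ∖ ｛ u ｝} e

      F∖e⊆X∪u : F ∖ ｛ e ｝ ⊆ X ∪ ｛ u ｝
      F∖e⊆X∪u fe with ∖-∪-cover em {F ∖ ｛ e ｝} u fe
      ... | inj₁ ((f , e≢x) , u≢x) = inj₁ ((f , u≢x) , e≢x)
      ... | inj₂ u≡x               = inj₂ u≡x

      u∉τX : u ∉ τ X
      u∉τX u∈τX = e∉τX (τ-absorbs (proj₁ hτ) u∈τX (monotone F∖e⊆X∪u e∈τF∖e))

    ∉Shade-mono : ∀ {F G u} → u ∉ Shade τ F → F ∖ ｛ u ｝ ⊆ G ∖ ｛ u ｝ → u ∉ Shade τ G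
    ∉Shade-mono u∉ShadeF F∖u⊆G∖u u∈ShadeG =
      u∉ShadeF λ u∈τF∖u → u∈ShadeG (monotone F∖u⊆G∖u u∈τF∖u)

    Shade-⊆-agreeing-off : ∀ {F G u} → u ∉ Shade τ F →
                           F ∖ ｛ u ｝ ⊆ G ∖ ｛ u ｝ → Shade τ G ⊆ Shade τ F
    Shade-⊆-agreeing-off {u = u} u∉ShadeF F∖u⊆G∖u {e} e∈ShadeG with em {u ≡ e}
    ... | yes refl = ⊥-elim (∉Shade-mono u∉ShadeF F∖u⊆G∖u e∈ShadeG)
    ... | no  u≢e  = Shade-from-∖-nonshade u∉ShadeF u≢e
      (Shade-antitone monotone F∖u⊆G∖u
        (Shade-antitone monotone proj₁ e∈ShadeG))

    Shade-≐-agreeing-off : ∀ {F G u} → u ∉ Shade τ F →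
                           G ∖ ｛ u ｝ ≐ F ∖ ｛ u ｝ → Shade τ G ≐ Shade τ F
    Shade-≐-agreeing-off u∉ShadeF (G∖u⊆F∖u , F∖u⊆G∖u) =
      Shade-⊆-agreeing-off u∉ShadeF F∖u⊆G∖u ,
      Shade-⊆-agreeing-off (∉Shade-mono u∉ShadeF F∖u⊆G∖u) G∖u⊆F∖u

    Shade-isShadeMap : IsShadeMap (Shade τ)
    Shade-isShadeMap F u u∉ShadeF =
      Shade-≐-agreeing-off u∉ShadeF (∪-∖-same u) , Shade-≐-agreeing-off u∉ShadeF (∖-∖-same u)

theorem4p18 : {ℓ : Level} → ExcludedMiddle ℓ → (E : Set ℓ) → (τ : Pred E ℓ → Pred E ℓ) →
    IsAntimatroidalQuasiClosure τ →
    InclusionReversing (Shade τ) × IsShadeMap (Shade τ)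
theorem4p18 em E τ hτ =
  Shade-antitone (IsQuasiClosure.monotone (proj₁ hτ)) , Shade-isShadeMap em hτ
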